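{- Let $n\geq1$. The degree bi-enumerators of all subgraphs $G\subseteq K_{2,n}$ are precisely the vectors $$b_n(i,j,k):=({\bf 1}_i+{\bf 1}_j)\oplus(n-(i+j)+k,\ (i+j)-2k,\ k)\in\mathbb{R}^{n+1}\oplus\mathbb{R}^{3},$$ for $i=0,1,\dots,n$, $j=i,\dots,n$, $k=\max\{0,(i+j)-n\},\dots,i$; moreover $b_n(i,j,k)=b(G_n(i,j,k))$. Their number is $\frac{(n+2)(n+4)(2n+3)}{24}$ for even $n$ and $\frac{(n+1)(n+3)(2n+7)}{24}$ for odd $n$.
   Context: $K_{2,n}=(U,V,E)$ is the complete bipartite graph with left vertices $U=\{u_1,u_2\}$, right vertices $V=\{v_1,\dots,v_n\}$, $E=U\times V$. A subgraph $G\subseteq K_{2,n}$ has the same vertex sets and edge set contained in $E$. Its degree bi-enumerator is $b(G)=a(G)\oplus c(G)\in\mathbb{R}^{n+1}\oplus\mathbb{R}^{3}$, where $a_k(G)$ ($k=0,\dots,n$) is the number of left vertices of degree $k$ and $c_k(G)$ ($k=0,1,2$) is the number of right vertices of degree $k$; vectors are indexed from $0$ and ${\bf 1}_k$ is the $k$-th unit vector of $\mathbb{R}^{n+1}$. For $i,j,k$ in the stated ranges, $G_n(i,j,k)$ denotes a subgraph obtained by choosing an $i$-subset $N_1\subseteq V$ and a $j$-subset $N_2\subseteq V$ with $|N_1\cap N_2|=k$ and joining $u_r$ to all vertices of $N_r$ for $r=1,2$. -}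

module Defs where

open import Data.Nat using (ℕ; zero; suc; _+_; _*_; _∸_; _≡ᵇ_)
open import Data.Bool using (Bool; true; false; if_then_else_)
open import Data.Fin using (Fin; toℕ)
open import Data.Vec using (Vec; tabulate; lookup; _∷_; [])
open import Data.Vec.Functional using (zipWith)
open import Data.Product using (_×_; _,_)
open import Data.Fin.Subset using (Subset)
import Data.Fin as Fin

countFin : (m : ℕ) → (Fin m → Bool) → ℕ
countFin zero    p = 0
countFin (suc m) p = (if p Fin.zero then 1 else 0) + countFin m (λ t → p (Fin.suc t))

-- A subgraph of K_{2,n} = (U,V,E), U = {u_1,u_2} ≅ Fin 2, V = {v_1..v_n} ≅ Fin n:
-- given by its edge set, a subset of U × V (characteristic function).
Subgraph : ℕ → Set
Subgraph n = Fin 2 → Fin n → Bool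

degL : {n : ℕ} → Subgraph n → Fin 2 → ℕ
degL {n} G r = countFin n (λ v → G r v)

degR : {n : ℕ} → Subgraph n → Fin n → ℕ
degR G v = countFin 2 (λ r → G r v)

aVec : {n : ℕ} → Subgraph n → Vec ℕ (suc n)
aVec G = tabulate (λ k → countFin 2 (λ r → degL G r ≡ᵇ toℕ k))

cVec : {n : ℕ} → Subgraph n → Vec ℕ 3
cVec {n} G = tabulate (λ k → countFin n (λ v → degR G v ≡ᵇ toℕ k))

BiEnum : ℕ → Set
BiEnum n = Vec ℕ (suc n) × Vec ℕ 3

bi : {n : ℕ} → Subgraph n → BiEnum n
bi G = aVec G , cVec G

unit : (n i : ℕ) → Vec ℕ (suc n)
unit n i = tabulate (λ t → if toℕ t ≡ᵇ i then 1 else 0)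

_⊞_ : {m : ℕ} → Vec ℕ m → Vec ℕ m → Vec ℕ m
_⊞_ {m} u v = tabulate (λ t → lookup u t + lookup v t)

-- b_n(i,j,k) = (1_i + 1_j) ⊕ (n-(i+j)+k, (i+j)-2k, k)
-- (in the stated index ranges all entries are natural numbers, so truncated
--  subtraction ∸ agrees with real subtraction)
bn : (n i j k : ℕ) → BiEnum n
bn n i j k = (unit n i ⊞ unit n j) , ((n + k) ∸ (i + j)) ∷ ((i + j) ∸ (2 * k)) ∷ k ∷ []

-- G_n(i,j,k) built from the chosen sets N_1, N_2 ⊆ V: u_r joined to all of N_r
fromNbhd : {n : ℕ} → Subset n → Subset n → Subgraph n
fromNbhd N₁ N₂ Fin.zero v = lookup N₁ v
fromNbhd N₁ N₂ (Fin.suc _) v = lookup N₂ v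

-- A subgraph is given by the neighbourhoods N₁, N₂ of u₁, u₂. Its left degrees are
-- i = |N₁| and j = |N₂|, and a right vertex has degree 2, 1 or 0 according as it lies
-- in N₁ ∩ N₂, in exactly one of them, or in neither; with k = |N₁ ∩ N₂| this gives
-- c = (n − (i + j) + k, i + j − 2k, k), i.e. b(G) = b_n(i, j, k). Conversely each
-- admissible (i, j, k) is realised by k common, i − k and j − k private, and
-- n − (i + j) + k isolated right vertices. Distinct admissible triples give distinct
-- vectors: k is the last entry, min(i, j) the least index in the support of 1_i + 1_j,
-- and i + j is read off the middle entry. So the bi-enumerators are counted by the
-- triples (k, p, q) with p ≤ q and k + p + q ≤ n, and a parity induction evaluates
-- that count.
module Submission where

open import Defs
open import Data.Bool as Bool using (Bool; true; false; if_then_else_; _∧_; T)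
open import Data.Fin using (Fin; zero; suc; toℕ; fromℕ<)
open import Data.Fin.Patterns using (0F; 1F; 2F)
open import Data.Fin.Properties using (toℕ-fromℕ<)
open import Data.Fin.Subset using (Subset; ∣_∣; _∩_)
open import Data.List using (List; []; _∷_; _++_; map; length)
open import Data.List.Membership.Propositional using (_∈_)
open import Data.List.Membership.Propositional.Properties using (∈-map⁺; ∈-map⁻; ∈-++⁺ˡ; ∈-++⁺ʳ; ∈-++⁻)
open import Data.List.Properties using (length-map; length-++)
open import Data.List.Relation.Unary.All as All using (All)
open import Data.List.Relation.Unary.AllPairs using ([]; _∷_)
open import Data.List.Relation.Unary.Any using (here; there)
open import Data.List.Relation.Unary.Unique.Propositional using (Unique)
import Data.List.Relation.Unary.Unique.Propositional.Properties as Unique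
open import Data.Nat using (ℕ; zero; suc; _+_; _*_; _∸_; _≤_; _<_; _%_; _/_; _≡ᵇ_; z≤n; s≤s; _≤?_)
open import Data.Nat.DivMod using (m≡m%n+[m/n]*n)
open import Data.Nat.Properties
open import Algebra.Properties.Monoid.Sum +-0-monoid using (sum)
open import Data.Nat.Tactic.RingSolver using (solve-∀)
open import Data.Product using (_×_; _,_; Σ; ∃-syntax; proj₁; proj₂)
import Data.Product as Product
open import Data.Sum using (_⊎_; inj₁; inj₂; [_,_]′)
open import Data.Unit using (tt)
open import Data.Vec using (tabulate; lookup; []; _∷_)
open import Data.Vec.Properties using (lookup∘tabulate; tabulate-cong)
open import Function using (_∘_)
open import Function.Bundles using (_⇔_; mk⇔)
open import Relation.Binary.PropositionalEquality
open import Relation.Nullary using (¬_; Dec; yes; no)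

private variable
  m n p q s i j k i′ j′ k′ : ℕ

indicator : Bool → ℕ
indicator b = if b then 1 else 0

≡ᵇ-sym : ∀ m n → (m ≡ᵇ n) ≡ (n ≡ᵇ m)
≡ᵇ-sym zero    zero    = refl
≡ᵇ-sym zero    (suc n) = refl
≡ᵇ-sym (suc m) zero    = refl
≡ᵇ-sym (suc m) (suc n) = ≡ᵇ-sym m n

≡ᵇ-refl : ∀ m → (m ≡ᵇ m) ≡ true
≡ᵇ-refl zero    = refl
≡ᵇ-refl (suc m) = ≡ᵇ-refl m

indicator-+-pos : ∀ a b → 0 < indicator a + indicator b → T a ⊎ T b
indicator-+-pos true  _     _ = inj₁ tt
indicator-+-pos false true  _ = inj₂ tt

countFin-cong : {p q : Fin n → Bool} → (∀ v → p v ≡ q v) → countFin n p ≡ countFin n q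
countFin-cong {zero}  p≗q = refl
countFin-cong {suc n} p≗q = cong₂ _+_ (cong indicator (p≗q zero)) (countFin-cong (p≗q ∘ suc))

countFin-mono : {p q : Fin n → Bool} → (∀ v → p v Bool.≤ q v) → countFin n p ≤ countFin n q
countFin-mono {zero}  p≤q = z≤n
countFin-mono {suc n} p≤q = +-mono-≤ (indicator-mono (p≤q zero)) (countFin-mono (p≤q ∘ suc))
  where
  indicator-mono : ∀ {a b} → a Bool.≤ b → indicator a ≤ indicator b
  indicator-mono Bool.b≤b = ≤-refl
  indicator-mono Bool.f≤t = z≤n

∧-≤ˡ : ∀ a b → a ∧ b Bool.≤ a
∧-≤ˡ false _     = Bool.b≤b
∧-≤ˡ true  false = Bool.f≤t
∧-≤ˡ true  true  = Bool.b≤b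

∧-≤ʳ : ∀ a b → a ∧ b Bool.≤ b
∧-≤ʳ false false = Bool.b≤b
∧-≤ʳ false true  = Bool.f≤t
∧-≤ʳ true  _     = Bool.b≤b

countFin-≤ : (p : Fin n → Bool) → countFin n p ≤ n
countFin-≤ {zero}  p = z≤n
countFin-≤ {suc n} p = +-mono-≤ (indicator≤1 (p zero)) (countFin-≤ (p ∘ suc))
  where
  indicator≤1 : ∀ b → indicator b ≤ 1
  indicator≤1 true  = ≤-refl
  indicator≤1 false = z≤n

countFin-lookup : (N : Subset n) → countFin n (lookup N) ≡ ∣ N ∣
countFin-lookup []          = refl
countFin-lookup (true  ∷ N) = cong suc (countFin-lookup N)
countFin-lookup (false ∷ N) = countFin-lookup N

countFin-∩ : (N₁ N₂ : Subset n) → countFin n (λ v → lookup N₁ v ∧ lookup N₂ v) ≡ ∣ N₁ ∩ N₂ ∣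
countFin-∩ []            []            = refl
countFin-∩ (true  ∷ N₁) (true  ∷ N₂) = cong suc (countFin-∩ N₁ N₂)
countFin-∩ (true  ∷ N₁) (false ∷ N₂) = countFin-∩ N₁ N₂
countFin-∩ (false ∷ N₁) (_     ∷ N₂) = countFin-∩ N₁ N₂

level : (Fin n → ℕ) → ℕ → ℕ
level {n} f k = countFin n (λ v → f v ≡ᵇ k)

levels-total : (f : Fin n → ℕ) → (∀ v → f v ≤ 2) → level f 0 + level f 1 + level f 2 ≡ n
levels-total {zero}  f f≤2 = refl
levels-total {suc n} f f≤2 = begin
  (a₀ + l₀) + (a₁ + l₁) + (a₂ + l₂) ≡⟨ interchange₃ a₀ a₁ a₂ l₀ l₁ l₂ ⟩
  (a₀ + a₁ + a₂) + (l₀ + l₁ + l₂)   ≡⟨ cong₂ _+_ (at-head (f zero) (f≤2 zero)) (levels-total (f ∘ suc) (f≤2 ∘ suc)) ⟩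
  suc n                             ∎
  where
  open ≡-Reasoning
  a₀ = indicator (f zero ≡ᵇ 0); a₁ = indicator (f zero ≡ᵇ 1); a₂ = indicator (f zero ≡ᵇ 2)
  l₀ = level (f ∘ suc) 0; l₁ = level (f ∘ suc) 1; l₂ = level (f ∘ suc) 2
  interchange₃ : ∀ a₀ a₁ a₂ l₀ l₁ l₂ → (a₀ + l₀) + (a₁ + l₁) + (a₂ + l₂) ≡ (a₀ + a₁ + a₂) + (l₀ + l₁ + l₂)
  interchange₃ = solve-∀
  at-head : ∀ x → x ≤ 2 → indicator (x ≡ᵇ 0) + indicator (x ≡ᵇ 1) + indicator (x ≡ᵇ 2) ≡ 1
  at-head 0 _ = refl
  at-head 1 _ = refl
  at-head 2 _ = refl
  at-head (suc (suc (suc _))) (s≤s (s≤s ()))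

levels-weighted : (f : Fin n → ℕ) → (∀ v → f v ≤ 2) → level f 1 + 2 * level f 2 ≡ sum f
levels-weighted {zero}  f f≤2 = refl
levels-weighted {suc n} f f≤2 = begin
  (a₁ + l₁) + 2 * (a₂ + l₂) ≡⟨ interchange a₁ a₂ l₁ l₂ ⟩
  (a₁ + 2 * a₂) + (l₁ + 2 * l₂) ≡⟨ cong₂ _+_ (at-head (f zero) (f≤2 zero)) (levels-weighted (f ∘ suc) (f≤2 ∘ suc)) ⟩
  f zero + sum (f ∘ suc)      ∎
  where
  open ≡-Reasoning
  a₁ = indicator (f zero ≡ᵇ 1); a₂ = indicator (f zero ≡ᵇ 2)
  l₁ = level (f ∘ suc) 1; l₂ = level (f ∘ suc) 2
  interchange : ∀ a₁ a₂ l₁ l₂ → (a₁ + l₁) + 2 * (a₂ + l₂) ≡ (a₁ + 2 * a₂) + (l₁ + 2 * l₂)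
  interchange = solve-∀
  at-head : ∀ x → x ≤ 2 → indicator (x ≡ᵇ 1) + 2 * indicator (x ≡ᵇ 2) ≡ x
  at-head 0 _ = refl
  at-head 1 _ = refl
  at-head 2 _ = refl
  at-head (suc (suc (suc _))) (s≤s (s≤s ()))

lookup-unit : ∀ i (t : Fin (suc n)) → lookup (unit n i) t ≡ indicator (toℕ t ≡ᵇ i)
lookup-unit i t = lookup∘tabulate (λ s → indicator (toℕ s ≡ᵇ i)) t

lookup-unit⊞unit : ∀ i j (t : Fin (suc n)) →
  lookup (unit n i ⊞ unit n j) t ≡ indicator (toℕ t ≡ᵇ i) + indicator (toℕ t ≡ᵇ j)
lookup-unit⊞unit {n} i j t =
  trans (lookup∘tabulate (λ s → lookup (unit n i) s + lookup (unit n j) s) t)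
        (cong₂ _+_ (lookup-unit i t) (lookup-unit j t))

commonNeighbours : Subgraph n → ℕ
commonNeighbours {n} G = countFin n (λ v → G 0F v ∧ G 1F v)

degR≤2 : (G : Subgraph n) (v : Fin n) → degR G v ≤ 2
degR≤2 G v = countFin-≤ (λ r → G r v)

degR≡2 : (G : Subgraph n) (v : Fin n) → (degR G v ≡ᵇ 2) ≡ (G 0F v ∧ G 1F v)
degR≡2 G v with G 0F v | G 1F v
... | true  | true  = refl
... | true  | false = refl
... | false | true  = refl
... | false | false = refl

sum-degR : (G : Subgraph n) → sum (degR G) ≡ degL G 0F + degL G 1F
sum-degR {zero}  G = refl
sum-degR {suc n} G = begin
  (a + (b + 0)) + sum (degR G′) ≡⟨ cong ((a + (b + 0)) +_) (sum-degR G′) ⟩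
  (a + (b + 0)) + (x + y)       ≡⟨ interchange a b x y ⟩
  (a + x) + (b + y)             ∎
  where
  open ≡-Reasoning
  G′ : Subgraph n
  G′ r v = G r (suc v)
  a = indicator (G 0F zero); b = indicator (G 1F zero)
  x = degL G′ 0F; y = degL G′ 1F
  interchange : ∀ a b x y → (a + (b + 0)) + (x + y) ≡ (a + x) + (b + y)
  interchange = solve-∀

module _ (G : Subgraph n) where
  open ≡-Reasoning
  private
    d₁ = degL G 0F
    d₂ = degL G 1F
    c = commonNeighbours G
    c₀ = level (degR G) 0
    c₁ = level (degR G) 1
    c₂ = level (degR G) 2

    c₂≡c : c₂ ≡ c
    c₂≡c = countFin-cong (degR≡2 G)

    c₁+2c≡d₁+d₂ : c₁ + 2 * c ≡ d₁ + d₂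
    c₁+2c≡d₁+d₂ = begin
      c₁ + 2 * c      ≡⟨ cong (λ m → c₁ + 2 * m) c₂≡c ⟨
      c₁ + 2 * c₂     ≡⟨ levels-weighted (degR G) (degR≤2 G) ⟩
      sum (degR G)    ≡⟨ sum-degR G ⟩
      d₁ + d₂         ∎

    c₀+d₁+d₂≡n+c : c₀ + (d₁ + d₂) ≡ n + c
    c₀+d₁+d₂≡n+c = begin
      c₀ + (d₁ + d₂)        ≡⟨ cong (c₀ +_) c₁+2c≡d₁+d₂ ⟨
      c₀ + (c₁ + 2 * c)     ≡⟨ regroup c₀ c₁ c ⟩
      (c₀ + c₁ + c) + c     ≡⟨ cong (λ m → (c₀ + c₁ + m) + c) c₂≡c ⟨
      (c₀ + c₁ + c₂) + c    ≡⟨ cong (_+ c) (levels-total (degR G) (degR≤2 G)) ⟩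
      n + c                 ∎
      where
      regroup : ∀ a b c → a + (b + 2 * c) ≡ (a + b + c) + c
      regroup = solve-∀

  degL+degL≤n+commonNeighbours : d₁ + d₂ ≤ n + c
  degL+degL≤n+commonNeighbours = subst (d₁ + d₂ ≤_) c₀+d₁+d₂≡n+c (m≤n+m (d₁ + d₂) c₀)

  bi≡bn : bi G ≡ bn n d₁ d₂ c
  bi≡bn = cong₂ _,_ aVec≡ (cong₂ _∷_ c₀≡ (cong₂ _∷_ c₁≡ (cong₂ _∷_ c₂≡c refl)))
    where
    aVec≡ : aVec G ≡ unit n d₁ ⊞ unit n d₂
    aVec≡ = tabulate-cong λ t → begin
      indicator (d₁ ≡ᵇ toℕ t) + (indicator (d₂ ≡ᵇ toℕ t) + 0)
        ≡⟨ cong₂ (λ a b → indicator a + b) (≡ᵇ-sym d₁ (toℕ t)) (+-identityʳ _) ⟩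
      indicator (toℕ t ≡ᵇ d₁) + indicator (d₂ ≡ᵇ toℕ t)
        ≡⟨ cong (λ a → indicator (toℕ t ≡ᵇ d₁) + indicator a) (≡ᵇ-sym d₂ (toℕ t)) ⟩
      indicator (toℕ t ≡ᵇ d₁) + indicator (toℕ t ≡ᵇ d₂)
        ≡⟨ cong₂ _+_ (lookup-unit d₁ t) (lookup-unit d₂ t) ⟨
      lookup (unit n d₁) t + lookup (unit n d₂) t ∎
    c₀≡ : c₀ ≡ (n + c) ∸ (d₁ + d₂)
    c₀≡ = trans (sym (m+n∸n≡m c₀ (d₁ + d₂))) (cong (_∸ (d₁ + d₂)) c₀+d₁+d₂≡n+c)
    c₁≡ : c₁ ≡ (d₁ + d₂) ∸ 2 * c
    c₁≡ = trans (sym (m+n∸n≡m c₁ (2 * c))) (cong (_∸ 2 * c) c₁+2c≡d₁+d₂)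

bn-comm : ∀ n i j k → bn n i j k ≡ bn n j i k
bn-comm n i j k = cong₂ _,_
  (tabulate-cong λ t → +-comm (lookup (unit n i) t) (lookup (unit n j) t))
  (cong (λ s → (n + k) ∸ s ∷ s ∸ 2 * k ∷ k ∷ []) (+-comm i j))

bi-inRange : (G : Subgraph n) → ∃[ i ] ∃[ j ] ∃[ k ]
  (i ≤ j × j ≤ n × (i + j) ∸ n ≤ k × k ≤ i × bi G ≡ bn n i j k)
bi-inRange {n} G = ordered (d₁ ≤? d₂)
  where
  d₁ = degL G 0F
  d₂ = degL G 1F
  c = commonNeighbours G
  c≤d₁ : c ≤ d₁
  c≤d₁ = countFin-mono λ v → ∧-≤ˡ (G 0F v) (G 1F v)
  c≤d₂ : c ≤ d₂
  c≤d₂ = countFin-mono λ v → ∧-≤ʳ (G 0F v) (G 1F v)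
  Conclusion : Set
  Conclusion = ∃[ i ] ∃[ j ] ∃[ k ] (i ≤ j × j ≤ n × (i + j) ∸ n ≤ k × k ≤ i × bi G ≡ bn n i j k)
  inRange : i ≤ j → j ≤ n → c ≤ i → i + j ≤ n + c → bi G ≡ bn n i j c → Conclusion
  inRange {i} {j} i≤j j≤n c≤i i+j≤n+c eq = i , j , c , i≤j , j≤n , m≤n+o⇒m∸n≤o (i + j) n i+j≤n+c , c≤i , eq
  ordered : Dec (d₁ ≤ d₂) → Conclusion
  ordered (yes d₁≤d₂) = inRange d₁≤d₂ (countFin-≤ (G 1F)) c≤d₁ (degL+degL≤n+commonNeighbours G) (bi≡bn G)
  ordered (no  d₁≰d₂) = inRange (≰⇒≥ d₁≰d₂) (countFin-≤ (G 0F)) c≤d₂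
    (subst (_≤ n + c) (+-comm d₁ d₂) (degL+degL≤n+commonNeighbours G))
    (trans (bi≡bn G) (bn-comm n d₁ d₂ c))

bi-fromNbhd : (N₁ N₂ : Subset n) → ∣ N₁ ∣ ≡ i → ∣ N₂ ∣ ≡ j → ∣ N₁ ∩ N₂ ∣ ≡ k →
  bi (fromNbhd N₁ N₂) ≡ bn n i j k
bi-fromNbhd N₁ N₂ refl refl refl
  rewrite sym (countFin-lookup N₁) | sym (countFin-lookup N₂) | sym (countFin-∩ N₁ N₂)
  = bi≡bn (fromNbhd N₁ N₂)

OverlappingSubsets : (n i j k : ℕ) → Set
OverlappingSubsets n i j k =
  Σ (Subset n) λ N₁ → Σ (Subset n) λ N₂ → (∣ N₁ ∣ ≡ i × ∣ N₂ ∣ ≡ j × ∣ N₁ ∩ N₂ ∣ ≡ k)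

overlappingSubsets : ∀ k p q r → OverlappingSubsets (k + (p + q) + r) (k + p) (k + q) k
overlappingSubsets (suc k) p q r with overlappingSubsets k p q r
... | N₁ , N₂ , e₁ , e₂ , e₃ = true ∷ N₁ , true ∷ N₂ , cong suc e₁ , cong suc e₂ , cong suc e₃
overlappingSubsets zero (suc p) q r with overlappingSubsets zero p q r
... | N₁ , N₂ , e₁ , e₂ , e₃ = true ∷ N₁ , false ∷ N₂ , cong suc e₁ , e₂ , e₃
overlappingSubsets zero zero (suc q) r with overlappingSubsets zero zero q r
... | N₁ , N₂ , e₁ , e₂ , e₃ = false ∷ N₁ , true ∷ N₂ , e₁ , cong suc e₂ , e₃
overlappingSubsets zero zero zero (suc r) with overlappingSubsets zero zero zero r
... | N₁ , N₂ , e₁ , e₂ , e₃ = false ∷ N₁ , false ∷ N₂ , e₁ , e₂ , e₃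
overlappingSubsets zero zero zero zero = [] , [] , refl , refl , refl

overlappingSubsets′ : ∀ {n} k p q → k + (p + q) ≤ n → OverlappingSubsets n (k + p) (k + q) k
overlappingSubsets′ k p q bound with r , refl ← m≤n⇒∃[o]m+o≡n bound = overlappingSubsets k p q r

inRange⇒shape : i ≤ j → (i + j) ∸ n ≤ k → k ≤ i →
  ∃[ p ] ∃[ q ] (p ≤ q × k + (p + q) ≤ n × i ≡ k + p × j ≡ k + q)
inRange⇒shape {i} {j} {n} {k} i≤j i+j∸n≤k k≤i
  with p , refl ← m≤n⇒∃[o]m+o≡n k≤i
     | q , refl ← m≤n⇒∃[o]m+o≡n (≤-trans k≤i i≤j)
  = p , q , +-cancelˡ-≤ k p q i≤j , +-cancelʳ-≤ k _ n bound , refl , refl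
  where
  bound : k + (p + q) + k ≤ n + k
  bound = begin
    k + (p + q) + k     ≡⟨ regroup k p q ⟩
    (k + p) + (k + q)   ≤⟨ m≤n+m∸n _ n ⟩
    n + ((k + p) + (k + q) ∸ n) ≤⟨ +-monoʳ-≤ n i+j∸n≤k ⟩
    n + k               ∎
    where
    open ≤-Reasoning
    regroup : ∀ k p q → k + (p + q) + k ≡ (k + p) + (k + q)
    regroup = solve-∀

overlappingSubsets-inRange : i ≤ j → (i + j) ∸ n ≤ k → k ≤ i → OverlappingSubsets n i j k
overlappingSubsets-inRange {n = n} i≤j i+j∸n≤k k≤i with inRange⇒shape {n = n} i≤j i+j∸n≤k k≤i
... | p , q , _ , bound , refl , refl = overlappingSubsets′ _ p q bound

unit⊞unit-min : i′ ≤ j′ → i ≤ n → unit n i ⊞ unit n j ≡ unit n i′ ⊞ unit n j′ → i′ ≤ i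
unit⊞unit-min {i′} {j′} {i} {n} {j} i′≤j′ i≤n eq =
  [ (λ t≡i′ → ≤-reflexive (trans (sym (≡ᵇ⇒≡ _ _ t≡i′)) toℕt≡i))
  , (λ t≡j′ → ≤-trans i′≤j′ (≤-reflexive (trans (sym (≡ᵇ⇒≡ _ _ t≡j′)) toℕt≡i)))
  ]′ (indicator-+-pos (toℕ t ≡ᵇ i′) (toℕ t ≡ᵇ j′) positive)
  where
  t : Fin (suc n)
  t = fromℕ< (s≤s i≤n)
  toℕt≡i : toℕ t ≡ i
  toℕt≡i = toℕ-fromℕ< (s≤s i≤n)
  open ≤-Reasoning
  positive : 0 < indicator (toℕ t ≡ᵇ i′) + indicator (toℕ t ≡ᵇ j′)
  positive = begin-strict
    0                                                  <⟨ s≤s z≤n ⟩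
    indicator true + indicator (i ≡ᵇ j)                ≡⟨ cong (λ b → indicator b + indicator (i ≡ᵇ j)) (≡ᵇ-refl i) ⟨
    indicator (i ≡ᵇ i) + indicator (i ≡ᵇ j)            ≡⟨ cong (λ m → indicator (m ≡ᵇ i) + indicator (m ≡ᵇ j)) toℕt≡i ⟨
    indicator (toℕ t ≡ᵇ i) + indicator (toℕ t ≡ᵇ j)    ≡⟨ lookup-unit⊞unit i j t ⟨
    lookup (unit n i ⊞ unit n j) t                     ≡⟨ cong (λ u → lookup u t) eq ⟩
    lookup (unit n i′ ⊞ unit n j′) t                   ≡⟨ lookup-unit⊞unit i′ j′ t ⟩
    indicator (toℕ t ≡ᵇ i′) + indicator (toℕ t ≡ᵇ j′)  ∎

bn-injective : i ≤ j → i ≤ n → k ≤ i → i′ ≤ j′ → i′ ≤ n → k′ ≤ i′ →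
  bn n i j k ≡ bn n i′ j′ k′ → i ≡ i′ × j ≡ j′ × k ≡ k′
bn-injective {i} {j} {n} {k} {i′} {j′} {k′} i≤j i≤n k≤i i′≤j′ i′≤n k′≤i′ eq =
  i≡i′ , +-cancelˡ-≡ i j j′ (trans i+j≡i′+j′ (cong (_+ j′) (sym i≡i′))) , k≡k′
  where
  k≡k′ : k ≡ k′
  k≡k′ = cong (λ b → lookup (proj₂ b) 2F) eq
  i≡i′ : i ≡ i′
  i≡i′ = ≤-antisym (unit⊞unit-min {j = j′} i≤j i′≤n (sym (cong proj₁ eq)))
                   (unit⊞unit-min {j = j} i′≤j′ i≤n (cong proj₁ eq))
  2k≤ : ∀ {i j k} → i ≤ j → k ≤ i → 2 * k ≤ i + j
  2k≤ {k = k} i≤j k≤i = +-mono-≤ k≤i (subst (_≤ _) (sym (+-identityʳ k)) (≤-trans k≤i i≤j))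
  i+j≡i′+j′ : i + j ≡ i′ + j′
  i+j≡i′+j′ = ∸-cancelʳ-≡ (2k≤ i≤j k≤i) (subst (λ m → 2 * m ≤ i′ + j′) (sym k≡k′) (2k≤ i′≤j′ k′≤i′))
    (trans (cong (λ b → lookup (proj₂ b) 1F) eq) (cong (λ m → (i′ + j′) ∸ 2 * m) (sym k≡k′)))

sortedPairsOfSum : ℕ → List (ℕ × ℕ)
sortedPairsOfSum zero          = (0 , 0) ∷ []
sortedPairsOfSum (suc zero)    = (0 , 1) ∷ []
sortedPairsOfSum (suc (suc s)) = (0 , suc (suc s)) ∷ map (Product.map suc suc) (sortedPairsOfSum s)

sortedPairsUpTo : ℕ → List (ℕ × ℕ)
sortedPairsUpTo zero    = sortedPairsOfSum zero
sortedPairsUpTo (suc m) = sortedPairsUpTo m ++ sortedPairsOfSum (suc m)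

-- The shape (k , p , q) stands for the triple (i , j , k) = (k + p , k + q , k).
shapes : ℕ → List (ℕ × ℕ × ℕ)
shapes zero    = map (0 ,_) (sortedPairsUpTo zero)
shapes (suc n) = map (0 ,_) (sortedPairsUpTo (suc n)) ++ map (Product.map₁ suc) (shapes n)

∈-sortedPairsOfSum⁻ : (p , q) ∈ sortedPairsOfSum s → p ≤ q × p + q ≡ s
∈-sortedPairsOfSum⁻ {s = zero}          (here refl) = z≤n , refl
∈-sortedPairsOfSum⁻ {s = suc zero}      (here refl) = z≤n , refl
∈-sortedPairsOfSum⁻ {s = suc (suc s)}   (here refl) = z≤n , refl
∈-sortedPairsOfSum⁻ {s = suc (suc s)}   (there x∈) with ∈-map⁻ (Product.map suc suc) x∈
... | (p , q) , pq∈ , refl with ∈-sortedPairsOfSum⁻ pq∈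
...   | p≤q , refl = s≤s p≤q , cong suc (+-suc p q)

∈-sortedPairsOfSum⁺ : p ≤ q → (p , q) ∈ sortedPairsOfSum (p + q)
∈-sortedPairsOfSum⁺ {zero} {zero}          _ = here refl
∈-sortedPairsOfSum⁺ {zero} {suc zero}      _ = here refl
∈-sortedPairsOfSum⁺ {zero} {suc (suc q)}   _ = here refl
∈-sortedPairsOfSum⁺ {suc p} {suc q} (s≤s p≤q) rewrite +-suc p q =
  there (∈-map⁺ (Product.map suc suc) (∈-sortedPairsOfSum⁺ p≤q))

∈-sortedPairsUpTo⁻ : (p , q) ∈ sortedPairsUpTo m → p ≤ q × p + q ≤ m
∈-sortedPairsUpTo⁻ {m = zero} x∈ = Product.map₂ ≤-reflexive (∈-sortedPairsOfSum⁻ x∈)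
∈-sortedPairsUpTo⁻ {m = suc m} x∈ with ∈-++⁻ (sortedPairsUpTo m) x∈
... | inj₁ x∈′ = Product.map₂ m≤n⇒m≤1+n (∈-sortedPairsUpTo⁻ x∈′)
... | inj₂ x∈′ = Product.map₂ ≤-reflexive (∈-sortedPairsOfSum⁻ x∈′)

∈-sortedPairsUpTo⁺ : p ≤ q → p + q ≤ m → (p , q) ∈ sortedPairsUpTo m
∈-sortedPairsUpTo⁺ {p} {q} {m = zero} p≤q p+q≤0 =
  subst (λ s → (p , q) ∈ sortedPairsOfSum s) (n≤0⇒n≡0 p+q≤0) (∈-sortedPairsOfSum⁺ p≤q)
∈-sortedPairsUpTo⁺ {p} {q} {m = suc m} p≤q p+q≤1+m with m≤n⇒m<n∨m≡n p+q≤1+m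
... | inj₁ (s≤s p+q≤m) = ∈-++⁺ˡ (∈-sortedPairsUpTo⁺ p≤q p+q≤m)
... | inj₂ p+q≡1+m    =
  ∈-++⁺ʳ (sortedPairsUpTo m) (subst (λ s → (p , q) ∈ sortedPairsOfSum s) p+q≡1+m (∈-sortedPairsOfSum⁺ p≤q))

∈-shapes⁻ : (k , p , q) ∈ shapes n → p ≤ q × k + (p + q) ≤ n
∈-shapes⁻ {n = zero} x∈ with ∈-map⁻ (0 ,_) x∈
... | _ , pq∈ , refl = ∈-sortedPairsUpTo⁻ pq∈
∈-shapes⁻ {n = suc n} x∈ with ∈-++⁻ (map (0 ,_) (sortedPairsUpTo (suc n))) x∈
... | inj₁ x∈′ with ∈-map⁻ (0 ,_) x∈′
...   | _ , pq∈ , refl = ∈-sortedPairsUpTo⁻ pq∈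
∈-shapes⁻ {n = suc n} x∈ | inj₂ x∈′ with ∈-map⁻ (Product.map₁ suc) x∈′
...   | _ , kpq∈ , refl = Product.map₂ s≤s (∈-shapes⁻ kpq∈)

∈-shapes⁺ : p ≤ q → k + (p + q) ≤ n → (k , p , q) ∈ shapes n
∈-shapes⁺ {k = zero} {n = zero} p≤q bound = ∈-map⁺ (0 ,_) (∈-sortedPairsUpTo⁺ p≤q bound)
∈-shapes⁺ {k = zero} {n = suc n} p≤q bound = ∈-++⁺ˡ (∈-map⁺ (0 ,_) (∈-sortedPairsUpTo⁺ p≤q bound))
∈-shapes⁺ {k = suc k} {n = suc n} p≤q (s≤s bound) =
  ∈-++⁺ʳ (map (0 ,_) (sortedPairsUpTo (suc n))) (∈-map⁺ (Product.map₁ suc) (∈-shapes⁺ p≤q bound))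

sortedPairsOfSum-unique : ∀ s → Unique (sortedPairsOfSum s)
sortedPairsOfSum-unique zero          = All.[] ∷ []
sortedPairsOfSum-unique (suc zero)    = All.[] ∷ []
sortedPairsOfSum-unique (suc (suc s)) =
  All.tabulate head∉ ∷ Unique.map⁺ suc-suc-injective (sortedPairsOfSum-unique s)
  where
  head∉ : ∀ {x} → x ∈ map (Product.map suc suc) (sortedPairsOfSum s) → (0 , suc (suc s)) ≢ x
  head∉ x∈ with ∈-map⁻ (Product.map suc suc) x∈
  head∉ x∈ | _ , _ , refl = λ ()
  suc-suc-injective : ∀ {x y} → Product.map suc suc x ≡ Product.map suc suc y → x ≡ y
  suc-suc-injective {_ , _} {_ , _} refl = refl

sortedPairsUpTo-unique : ∀ m → Unique (sortedPairsUpTo m)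
sortedPairsUpTo-unique zero    = sortedPairsOfSum-unique zero
sortedPairsUpTo-unique (suc m) =
  Unique.++⁺ (sortedPairsUpTo-unique m) (sortedPairsOfSum-unique (suc m)) disjoint
  where
  disjoint : ∀ {x} → ¬ (x ∈ sortedPairsUpTo m × x ∈ sortedPairsOfSum (suc m))
  disjoint {_ , _} (x∈ , x∈′) =
    <-irrefl (proj₂ (∈-sortedPairsOfSum⁻ x∈′)) (s≤s (proj₂ (∈-sortedPairsUpTo⁻ x∈)))

shapes-unique : ∀ n → Unique (shapes n)
shapes-unique zero    = Unique.map⁺ {f = 0 ,_} (cong proj₂) (sortedPairsUpTo-unique zero)
shapes-unique (suc n) = Unique.++⁺
  (Unique.map⁺ {f = 0 ,_} (cong proj₂) (sortedPairsUpTo-unique (suc n)))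
  (Unique.map⁺ suc-injective′ (shapes-unique n))
  disjoint
  where
  suc-injective′ : ∀ {x y} → Product.map₁ suc x ≡ Product.map₁ suc y → x ≡ y
  suc-injective′ {_ , _} {_ , _} refl = refl
  disjoint : ∀ {x} → ¬ (x ∈ map (0 ,_) (sortedPairsUpTo (suc n)) × x ∈ map (Product.map₁ suc) (shapes n))
  disjoint (x∈ , x∈′) with ∈-map⁻ (0 ,_) x∈ | ∈-map⁻ (Product.map₁ suc) x∈′
  ... | _ , _ , refl | _ , _ , ()

length-sortedPairsOfSum : ∀ t → length (sortedPairsOfSum (t * 2)) ≡ suc t
                              × length (sortedPairsOfSum (suc (t * 2))) ≡ suc t
length-sortedPairsOfSum zero    = refl , refl
length-sortedPairsOfSum (suc t) =
  cong suc (trans (length-map (Product.map suc suc) (sortedPairsOfSum (t * 2))) (proj₁ (length-sortedPairsOfSum t))) ,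
  cong suc (trans (length-map (Product.map suc suc) (sortedPairsOfSum (suc (t * 2)))) (proj₂ (length-sortedPairsOfSum t)))

length-sortedPairsUpTo : ∀ t → length (sortedPairsUpTo (t * 2)) ≡ suc t * suc t
                             × length (sortedPairsUpTo (suc (t * 2))) ≡ suc t * suc (suc t)
length-sortedPairsUpTo zero    = refl , refl
length-sortedPairsUpTo (suc t) = even , odd
  where
  open ≡-Reasoning
  even : length (sortedPairsUpTo (suc t * 2)) ≡ suc (suc t) * suc (suc t)
  even = begin
    length (sortedPairsUpTo (suc (t * 2)) ++ sortedPairsOfSum (suc t * 2))
      ≡⟨ length-++ (sortedPairsUpTo (suc (t * 2))) ⟩
    length (sortedPairsUpTo (suc (t * 2))) + length (sortedPairsOfSum (suc t * 2))
      ≡⟨ cong₂ _+_ (proj₂ (length-sortedPairsUpTo t)) (proj₁ (length-sortedPairsOfSum (suc t))) ⟩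
    suc t * suc (suc t) + suc (suc t)
      ≡⟨ +-comm (suc t * suc (suc t)) (suc (suc t)) ⟩
    suc (suc t) * suc (suc t) ∎
  odd : length (sortedPairsUpTo (suc (suc t * 2))) ≡ suc (suc t) * suc (suc (suc t))
  odd = begin
    length (sortedPairsUpTo (suc t * 2) ++ sortedPairsOfSum (suc (suc t * 2)))
      ≡⟨ length-++ (sortedPairsUpTo (suc t * 2)) ⟩
    length (sortedPairsUpTo (suc t * 2)) + length (sortedPairsOfSum (suc (suc t * 2)))
      ≡⟨ cong₂ _+_ even (proj₂ (length-sortedPairsOfSum (suc t))) ⟩
    suc (suc t) * suc (suc t) + suc (suc t)
      ≡⟨ +-comm (suc (suc t) * suc (suc t)) (suc (suc t)) ⟩
    suc (suc t) + suc (suc t) * suc (suc t)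
      ≡⟨ *-suc (suc (suc t)) (suc (suc t)) ⟨
    suc (suc t) * suc (suc (suc t)) ∎

length-shapes-suc : ∀ n → length (shapes (suc n)) ≡ length (sortedPairsUpTo (suc n)) + length (shapes n)
length-shapes-suc n = trans (length-++ (map (0 ,_) (sortedPairsUpTo (suc n))) {map (Product.map₁ suc) (shapes n)})
  (cong₂ _+_ (length-map _ (sortedPairsUpTo (suc n))) (length-map _ (shapes n)))

evenFormula oddFormula : ℕ → ℕ
evenFormula n = (n + 2) * (n + 4) * (2 * n + 3)
oddFormula  n = (n + 1) * (n + 3) * (2 * n + 7)

length-shapes : ∀ t → 24 * length (shapes (t * 2)) ≡ evenFormula (t * 2)
                    × 24 * length (shapes (suc (t * 2))) ≡ oddFormula (suc (t * 2))
length-shapes zero    = refl , refl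
length-shapes (suc t) = even , odd
  where
  open ≡-Reasoning
  even : 24 * length (shapes (suc t * 2)) ≡ evenFormula (suc t * 2)
  even = begin
    24 * length (shapes (suc t * 2))
      ≡⟨ cong (24 *_) (length-shapes-suc (suc (t * 2))) ⟩
    24 * (length (sortedPairsUpTo (suc t * 2)) + length (shapes (suc (t * 2))))
      ≡⟨ *-distribˡ-+ 24 (length (sortedPairsUpTo (suc t * 2))) _ ⟩
    24 * length (sortedPairsUpTo (suc t * 2)) + 24 * length (shapes (suc (t * 2)))
      ≡⟨ cong₂ _+_ (cong (24 *_) (proj₁ (length-sortedPairsUpTo (suc t)))) (proj₂ (length-shapes t)) ⟩
    24 * (suc (suc t) * suc (suc t)) + oddFormula (suc (t * 2))
      ≡⟨ step t ⟩
    evenFormula (suc t * 2) ∎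
    where
    step : ∀ t → 24 * ((2 + t) * (2 + t)) + (1 + t * 2 + 1) * (1 + t * 2 + 3) * (2 * (1 + t * 2) + 7)
               ≡ (2 + t * 2 + 2) * (2 + t * 2 + 4) * (2 * (2 + t * 2) + 3)
    step = solve-∀
  odd : 24 * length (shapes (suc (suc t * 2))) ≡ oddFormula (suc (suc t * 2))
  odd = begin
    24 * length (shapes (suc (suc t * 2)))
      ≡⟨ cong (24 *_) (length-shapes-suc (suc t * 2)) ⟩
    24 * (length (sortedPairsUpTo (suc (suc t * 2))) + length (shapes (suc t * 2)))
      ≡⟨ *-distribˡ-+ 24 (length (sortedPairsUpTo (suc (suc t * 2)))) _ ⟩
    24 * length (sortedPairsUpTo (suc (suc t * 2))) + 24 * length (shapes (suc t * 2))
      ≡⟨ cong₂ _+_ (cong (24 *_) (proj₂ (length-sortedPairsUpTo (suc t)))) even ⟩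
    24 * (suc (suc t) * suc (suc (suc t))) + evenFormula (suc t * 2)
      ≡⟨ step t ⟩
    oddFormula (suc (suc t * 2)) ∎
    where
    step : ∀ t → 24 * ((2 + t) * (3 + t)) + (2 + t * 2 + 2) * (2 + t * 2 + 4) * (2 * (2 + t * 2) + 3)
               ≡ (3 + t * 2 + 1) * (3 + t * 2 + 3) * (2 * (3 + t * 2) + 7)
    step = solve-∀

shapeBn : (n : ℕ) → ℕ × ℕ × ℕ → BiEnum n
shapeBn n (k , p , q) = bn n (k + p) (k + q) k

bienumerators : (n : ℕ) → List (BiEnum n)
bienumerators n = map (shapeBn n) (shapes n)

map⁺-injectiveOn : {A B : Set} {f : A → B} {xs : List A} →
  (∀ {x y} → x ∈ xs → y ∈ xs → f x ≡ f y → x ≡ y) → Unique xs → Unique (map f xs)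
map⁺-injectiveOn {xs = []}     f-inj []            = []
map⁺-injectiveOn {f = f} {xs = x ∷ xs} f-inj (x∉ ∷ unique) =
  All.tabulate fx∉ ∷ map⁺-injectiveOn (λ y∈ z∈ → f-inj (there y∈) (there z∈)) unique
  where
  fx∉ : ∀ {y} → y ∈ map f xs → f x ≢ y
  fx∉ y∈ fx≡y with ∈-map⁻ f y∈
  ... | z , z∈ , refl = All.lookup x∉ z∈ (f-inj (here refl) (there z∈) fx≡y)

shapeBn-injectiveOn : ∀ {x y} → x ∈ shapes n → y ∈ shapes n → shapeBn n x ≡ shapeBn n y → x ≡ y
shapeBn-injectiveOn {n} {k , p , q} {k′ , p′ , q′} x∈ y∈ eq
  with ∈-shapes⁻ x∈ | ∈-shapes⁻ y∈
... | p≤q , bound | p′≤q′ , bound′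
  with bn-injective (+-monoʳ-≤ k p≤q) (≤-trans (+-monoʳ-≤ k (m≤m+n p q)) bound) (m≤m+n k p)
                    (+-monoʳ-≤ k′ p′≤q′) (≤-trans (+-monoʳ-≤ k′ (m≤m+n p′ q′)) bound′) (m≤m+n k′ p′) eq
... | i≡i′ , j≡j′ , refl = cong₂ (λ p q → k , p , q) (+-cancelˡ-≡ k p p′ i≡i′) (+-cancelˡ-≡ k q q′ j≡j′)

∈-bienumerators : (v : BiEnum n) → (v ∈ bienumerators n) ⇔ (∃[ G ] (bi G ≡ v))
∈-bienumerators {n} v = mk⇔ realise classify
  where
  realise : v ∈ bienumerators n → ∃[ G ] (bi G ≡ v)
  realise v∈ with ∈-map⁻ (shapeBn n) v∈
  ... | (k , p , q) , x∈ , refl with overlappingSubsets′ k p q (proj₂ (∈-shapes⁻ x∈))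
  ... | N₁ , N₂ , e₁ , e₂ , e₃ = fromNbhd N₁ N₂ , bi-fromNbhd N₁ N₂ e₁ e₂ e₃
  classify : ∃[ G ] (bi G ≡ v) → v ∈ bienumerators n
  classify (G , refl) with bi-inRange G
  ... | i , j , k , i≤j , _ , i+j∸n≤k , k≤i , eq with inRange⇒shape {n = n} i≤j i+j∸n≤k k≤i
  ... | p , q , p≤q , bound , refl , refl =
    subst (_∈ bienumerators n) (sym eq) (∈-map⁺ (shapeBn n) (∈-shapes⁺ p≤q bound))

24*length-bienumerators-even : ∀ n → n % 2 ≡ 0 → 24 * length (bienumerators n) ≡ evenFormula n
24*length-bienumerators-even n n%2≡0 =
  trans (cong (24 *_) (length-map (shapeBn n) (shapes n)))
        (subst (λ m → 24 * length (shapes m) ≡ evenFormula m) (sym n≡) (proj₁ (length-shapes (n / 2))))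
  where
  n≡ : n ≡ n / 2 * 2
  n≡ = trans (m≡m%n+[m/n]*n n 2) (cong (_+ n / 2 * 2) n%2≡0)

24*length-bienumerators-odd : ∀ n → n % 2 ≡ 1 → 24 * length (bienumerators n) ≡ oddFormula n
24*length-bienumerators-odd n n%2≡1 =
  trans (cong (24 *_) (length-map (shapeBn n) (shapes n)))
        (subst (λ m → 24 * length (shapes m) ≡ oddFormula m) (sym n≡) (proj₂ (length-shapes (n / 2))))
  where
  n≡ : n ≡ suc (n / 2 * 2)
  n≡ = trans (m≡m%n+[m/n]*n n 2) (cong (_+ n / 2 * 2) n%2≡1)

proposition3p2 : (n : ℕ) → 1 ≤ n →
    ((G : Subgraph n) → ∃[ i ] ∃[ j ] ∃[ k ]
        (i ≤ j × j ≤ n × (i + j) ∸ n ≤ k × k ≤ i × bi G ≡ bn n i j k))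
    × ((i j k : ℕ) → i ≤ j → j ≤ n → (i + j) ∸ n ≤ k → k ≤ i →
        (Σ (Subset n) λ N₁ → Σ (Subset n) λ N₂ → (∣ N₁ ∣ ≡ i × ∣ N₂ ∣ ≡ j × ∣ N₁ ∩ N₂ ∣ ≡ k))
        × ((N₁ N₂ : Subset n) → ∣ N₁ ∣ ≡ i → ∣ N₂ ∣ ≡ j → ∣ N₁ ∩ N₂ ∣ ≡ k →
            bi (fromNbhd N₁ N₂) ≡ bn n i j k))
    × (Σ (List (BiEnum n)) λ xs → (Unique xs × ((v : BiEnum n) → ((v ∈ xs) ⇔ (∃[ G ] (bi G ≡ v))))
        × (n % 2 ≡ 0 → 24 * length xs ≡ (n + 2) * (n + 4) * (2 * n + 3))
        × (n % 2 ≡ 1 → 24 * length xs ≡ (n + 1) * (n + 3) * (2 * n + 7))))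
proposition3p2 n _ =
  bi-inRange ,
  (λ i j k i≤j _ i+j∸n≤k k≤i → overlappingSubsets-inRange i≤j i+j∸n≤k k≤i , bi-fromNbhd) ,
  bienumerators n ,
  map⁺-injectiveOn shapeBn-injectiveOn (shapes-unique n) ,
  ∈-bienumerators ,
  24*length-bienumerators-even n ,
  24*length-bienumerators-odd n
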